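{- Let $G$ be an acyclically edge $(\Delta(G)+2)$-critical graph and let $v$ be a vertex of $G$. If $n_2(v)\neq 0$, then $n_2(v)+n_3(v)\leq \Delta(G)-3$.
   Context: All graphs are finite and simple. A proper edge coloring is acyclic if there is no bichromatic cycle. $\chi'_a(G)$ is the least number of colors in an acyclic proper edge coloring of $G$. A graph $G$ is acyclically edge $k$-critical if $\chi'_a(G)>k$ and every proper subgraph of $G$ has an acyclic proper edge coloring with $k$ colors. $\Delta(G)$ is the maximum degree. For a vertex $v$, $N(v)$ is its neighborhood, $d(v)=|N(v)|$, and $n_j(v)=|\{x\in N(v): d(x)=j\}|$. -}

module Defs where

open import Data.Nat using (ℕ; zero; suc; _+_; _⊔_; _≡ᵇ_; _>_)
open import Data.Fin using (Fin; zero; suc; inject₁; fromℕ)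
open import Data.List using (List; map; foldr; allFin)
open import Data.Nat.ListAction using (sum)
open import Data.Bool using (Bool; true; false; if_then_else_; _∧_)
open import Data.Product using (Σ; ∃; _×_; _,_)
open import Data.Sum using (_⊎_)
open import Relation.Nullary using (¬_)
open import Relation.Binary.PropositionalEquality using (_≡_; _≢_)

Adj : ℕ → Set
Adj n = Fin n → Fin n → Bool

record Graph (n : ℕ) : Set where
  field
    adj     : Adj n
    adj-sym : ∀ u v → adj u v ≡ adj v u
    irrefl  : ∀ v → adj v v ≡ false
open Graph public

deg : ∀ {n} → Adj n → Fin n → ℕ
deg {n} A v = sum (map (λ u → if A v u then 1 else 0) (allFin n))

Δ : ∀ {n} → Graph n → ℕ
Δ {n} G = foldr _⊔_ 0 (map (deg (adj G)) (allFin n))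

nDeg : ∀ {n} → Graph n → ℕ → Fin n → ℕ
nDeg {n} G j v =
  sum (map (λ u → if adj G v u ∧ (deg (adj G) u ≡ᵇ j) then 1 else 0) (allFin n))

record EdgeColouring {n : ℕ} (A : Adj n) (k : ℕ) : Set where
  field
    col     : Fin n → Fin n → Fin k
    col-sym : ∀ u v → A u v ≡ true → col u v ≡ col v u
open EdgeColouring public

Proper : ∀ {n k} {A : Adj n} → EdgeColouring A k → Set
Proper {n} {k} {A} c =
  ∀ u v w → A u v ≡ true → A u w ≡ true → v ≢ w → col c u v ≢ col c u w

-- A cycle of length l+3 in A: distinct vertices w 0, …, w (l+2) with
-- w i ~ w (i+1) and w (l+2) ~ w 0.
record Cycle {n : ℕ} (A : Adj n) : Set where
  field
    len    : ℕ
    vert   : Fin (suc (suc (suc len))) → Fin n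
    inj    : ∀ i j → vert i ≡ vert j → i ≡ j
    step   : ∀ (i : Fin (suc (suc len))) → A (vert (inject₁ i)) (vert (suc i)) ≡ true
    close  : A (vert (fromℕ (suc (suc len)))) (vert zero) ≡ true
open Cycle public

Bichromatic : ∀ {n k} {A : Adj n} → EdgeColouring A k → Cycle A → Set
Bichromatic {n} {k} c C =
  Σ (Fin k) λ a → Σ (Fin k) λ b →
    (∀ (i : Fin (suc (suc (len C)))) →
       let x = col c (vert C (inject₁ i)) (vert C (suc i)) in (x ≡ a ⊎ x ≡ b))
    × (let x = col c (vert C (fromℕ (suc (suc (len C))))) (vert C zero) in (x ≡ a ⊎ x ≡ b))

Acyclic : ∀ {n k} {A : Adj n} → EdgeColouring A k → Set
Acyclic {A = A} c = ∀ (C : Cycle A) → ¬ Bichromatic c C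

AcyclicallyColourable : ∀ {n} → Adj n → ℕ → Set
AcyclicallyColourable A k =
  Σ (EdgeColouring A k) λ c → Proper c × Acyclic c

record Subgraph {n : ℕ} (G : Graph n) : Set where
  field
    inV      : Fin n → Bool
    adjH     : Adj n
    adjH-sym : ∀ u v → adjH u v ≡ adjH v u
    adjH⊆    : ∀ u v → adjH u v ≡ true → adj G u v ≡ true
    adjH-end : ∀ u v → adjH u v ≡ true → inV u ≡ true
open Subgraph public

ProperSubgraph : ∀ {n} {G : Graph n} → Subgraph G → Set
ProperSubgraph {n} {G} H =
  (∃ λ v → inV H v ≡ false) ⊎
  (∃ λ u → ∃ λ v → adj G u v ≡ true × adjH H u v ≡ false)

AcyclicallyEdgeCritical : ∀ {n} → Graph n → ℕ → Set
AcyclicallyEdgeCritical G k =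
  ¬ AcyclicallyColourable (adj G) k ×
  (∀ (H : Subgraph G) → ProperSubgraph H → AcyclicallyColourable (adjH H) k)

-- Let u be a neighbour of v of degree 2, with N(u) = {v, w}. By criticality G with the
-- edges at u removed has an acyclic proper (Δ+2)-edge-colouring φ, in which v and w each
-- miss at least three colours. The colouring extends to G (uv gets a colour α missing at v,
-- uw a colour β ≠ α missing at w) unless φ contains a walk v x y coloured β, α. Hence
-- every β missing at w colours an edge vx, and x sees every colour missing at v, so x has
-- degree at least 4. Distinct β give distinct x, so v has three neighbours of degree ≥ 4.
module Submission where

open import Defs
open import Data.Bool using (Bool; true; false; if_then_else_; _∧_; not; T)
import Data.Bool as Bool
open import Data.Bool.Properties using (∧-zeroʳ; ∧-comm; not-injective; ¬-not)
open import Data.Empty using (⊥)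
open import Data.Fin using (Fin; zero; suc; inject₁; fromℕ; toℕ)
open import Data.Fin.Properties using (_≟_; any?; toℕ-inject₁; toℕ-fromℕ)
open import Data.Fin.Relation.Unary.Top using (view; ‵fromℕ; ‵inject₁)
open import Data.List using (map; foldr; allFin; tabulate)
open import Data.List.Properties using (map-tabulate)
open import Data.List.Membership.Propositional using (_∈_)
open import Data.List.Membership.Propositional.Properties using (∈-allFin; ∈-map⁺)
open import Data.List.Relation.Unary.Any using (here; there)
open import Data.Nat using (ℕ; zero; suc; _+_; _≤_; _⊔_; _≡ᵇ_; z≤n; s≤s)
open import Data.Nat.ListAction using (sum)
open import Data.Nat.Properties
  using (≤-refl; ≤-trans; n≤1+n; ≤-reflexive; m≤n⇒m≤1+n; m≤m⊔n; m≤n⊔m; +-comm; +-assoc; +-suc;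
         +-monoˡ-≤; +-monoʳ-≤; +-cancelˡ-≤; m≢1+n+m; suc-injective; ≤-pred; m<n⇒n≢0; ≡ᵇ⇒≡; module ≤-Reasoning)
open import Data.Product using (∃; ∃₂; _×_; _,_; proj₁; proj₂)
open import Data.Sum using (_⊎_; inj₁; inj₂)
open import Data.Unit using (tt)
open import Function using (_∘_; id; case_of_)
open import Relation.Nullary using (¬_; Dec; yes; no; does; contradiction)
open import Relation.Nullary.Decidable using (toSum; dec-true; dec-false; decidable-stable; _×-dec_)
open import Relation.Binary.PropositionalEquality

∧≡true⇒ : ∀ {x y} → x ∧ y ≡ true → x ≡ true × y ≡ true
∧≡true⇒ {true} y≡true = refl , y≡true

_==_ : ∀ {n} → Fin n → Fin n → Bool
a == b = does (a ≟ b)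

==-refl : ∀ {n} (a : Fin n) → (a == a) ≡ true
==-refl a = dec-true (a ≟ a) refl

≢⇒==-false : ∀ {n} {a b : Fin n} → a ≢ b → (a == b) ≡ false
≢⇒==-false {a = a} {b} = dec-false (a ≟ b)

==-false⇒≢ : ∀ {n} {a b : Fin n} → (a == b) ≡ false → a ≢ b
==-false⇒≢ {a = a} eq refl = contradiction (trans (sym (==-refl a)) eq) λ ()

_∖_ : ∀ {n} → (Fin n → Bool) → Fin n → Fin n → Bool
(P ∖ a) x = P x ∧ not (x == a)

∖-intro : ∀ {n} (P : Fin n → Bool) {a x} → P x ≡ true → x ≢ a → (P ∖ a) x ≡ true
∖-intro P {a} {x} Px x≢a rewrite Px | ≢⇒==-false x≢a = refl

∖-elim : ∀ {n} (P : Fin n → Bool) {a x} → (P ∖ a) x ≡ true → P x ≡ true × x ≢ a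
∖-elim P e with ∧≡true⇒ e
... | Px , x≠a = Px , ==-false⇒≢ (not-injective x≠a)

indicator : Bool → ℕ
indicator b = if b then 1 else 0

count : ∀ {n} → (Fin n → Bool) → ℕ
count P = sum (tabulate (indicator ∘ P))

sum-indicator≡count : ∀ {n} (P : Fin n → Bool) →
  sum (map (indicator ∘ P) (allFin n)) ≡ count P
sum-indicator≡count P = cong sum (map-tabulate id (indicator ∘ P))

count-none : ∀ {n} (P : Fin n → Bool) → (∀ x → P x ≡ false) → count P ≡ 0
count-none {zero} P none = refl
count-none {suc n} P none rewrite none zero = count-none (P ∘ suc) (none ∘ suc)

count-witness : ∀ {n} (P : Fin n → Bool) → count P ≢ 0 → ∃ λ x → P x ≡ true
count-witness {zero} P count≢0 = contradiction refl count≢0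
count-witness {suc n} P count≢0 with P zero in P0
... | true = zero , P0
... | false with count-witness (P ∘ suc) count≢0
...   | x , Px = suc x , Px

count-mono : ∀ {n} (P Q : Fin n → Bool) → (∀ x → P x ≡ true → Q x ≡ true) → count P ≤ count Q
count-mono {zero} P Q P⊆Q = z≤n
count-mono {suc n} P Q P⊆Q with P zero in P0 | Q zero in Q0
... | true | true = s≤s (count-mono (P ∘ suc) (Q ∘ suc) (P⊆Q ∘ suc))
... | true | false = contradiction (trans (sym (P⊆Q zero P0)) Q0) λ ()
... | false | true = m≤n⇒m≤1+n (count-mono (P ∘ suc) (Q ∘ suc) (P⊆Q ∘ suc))
... | false | false = count-mono (P ∘ suc) (Q ∘ suc) (P⊆Q ∘ suc)

count-split : ∀ {n} (P Q : Fin n → Bool) →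
  count P ≡ count (λ x → P x ∧ Q x) + count (λ x → P x ∧ not (Q x))
count-split {zero} P Q = refl
count-split {suc n} P Q with P zero | Q zero | count-split (P ∘ suc) (Q ∘ suc)
... | true | true | ih = cong suc ih
... | true | false | ih = trans (cong suc ih) (sym (+-suc _ _))
... | false | _ | ih = ih

count-complement : ∀ {n} (P : Fin n → Bool) → count P + count (not ∘ P) ≡ n
count-complement {zero} P = refl
count-complement {suc n} P with P zero
... | true = cong suc (count-complement (P ∘ suc))
... | false = trans (+-suc _ _) (cong suc (count-complement (P ∘ suc)))

count-∧-singleton : ∀ {n} (P : Fin n → Bool) a → count (λ x → P x ∧ (x == a)) ≡ indicator (P a)
count-∧-singleton P zero with P zero
... | true = cong suc (count-none _ λ x → ∧-zeroʳ (P (suc x)))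
... | false = count-none _ λ x → ∧-zeroʳ (P (suc x))
count-∧-singleton P (suc a) rewrite ∧-zeroʳ (P zero) = count-∧-singleton (P ∘ suc) a

count-at : ∀ {n} (P : Fin n → Bool) a → count P ≡ indicator (P a) + count (P ∖ a)
count-at P a = trans (count-split P (_== a)) (cong (_+ count (P ∖ a)) (count-∧-singleton P a))

count-∖ : ∀ {n} (P : Fin n → Bool) {a} → P a ≡ true → count P ≡ suc (count (P ∖ a))
count-∖ P {a} Pa = trans (count-at P a) (cong (λ b → indicator b + count (P ∖ a)) Pa)

count-≤-∖ : ∀ {n} (P : Fin n → Bool) a → count P ≤ suc (count (P ∖ a))
count-≤-∖ P a = ≤-trans (≤-reflexive (count-at P a)) (+-monoˡ-≤ (count (P ∖ a)) (indicator≤1 (P a)))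
  where
  indicator≤1 : ∀ b → indicator b ≤ 1
  indicator≤1 true = ≤-refl
  indicator≤1 false = z≤n

count-positive : ∀ {n} (P : Fin n → Bool) {a} → P a ≡ true → count P ≢ 0
count-positive P Pa count≡0 with () ← trans (sym (count-∖ P Pa)) count≡0

count-other : ∀ {n} (P : Fin n → Bool) → 2 ≤ count P → ∀ a → ∃ λ x → P x ≡ true × x ≢ a
count-other P 2≤count a =
  let (x , x∈P∖a) = count-witness (P ∖ a) (m<n⇒n≢0 (≤-pred (≤-trans 2≤count (count-≤-∖ P a))))
  in x , ∖-elim P x∈P∖a

count-≡1 : ∀ {n} (P : Fin n → Bool) → count P ≡ 1 → ∃ λ b → P b ≡ true × (∀ x → P x ≡ true → x ≡ b)
count-≡1 P count≡1 with count-witness P (m<n⇒n≢0 (≤-reflexive (sym count≡1)))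
... | b , Pb = b , Pb , only-b
  where
  only-b : ∀ x → P x ≡ true → x ≡ b
  only-b x Px = decidable-stable (x ≟ b) λ x≢b →
    count-positive (P ∖ b) (∖-intro P Px x≢b) (suc-injective (trans (sym (count-∖ P Pb)) count≡1))

count-≡2 : ∀ {n} (P : Fin n → Bool) {a} → count P ≡ 2 → P a ≡ true →
  ∃ λ b → b ≢ a × P b ≡ true × (∀ x → P x ≡ true → x ≡ a ⊎ x ≡ b)
count-≡2 P {a} count≡2 Pa with count-≡1 (P ∖ a) (suc-injective (trans (sym (count-∖ P Pa)) count≡2))
... | b , b∈P∖a , only-b = b , proj₂ (∖-elim P b∈P∖a) , proj₁ (∖-elim P b∈P∖a) , only-a-b
  where
  only-a-b : ∀ x → P x ≡ true → x ≡ a ⊎ x ≡ b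
  only-a-b x Px with x ≟ a
  ... | yes x≡a = inj₁ x≡a
  ... | no x≢a = inj₂ (only-b x (∖-intro P Px x≢a))

count-≤-image : ∀ {m n} (P : Fin m → Bool) (Q : Fin n → Bool) (f : Fin n → Fin m) →
  (∀ x → P x ≡ true → ∃ λ y → Q y ≡ true × f y ≡ x) → count P ≤ count Q
count-≤-image {n = zero} P Q f cover =
  ≤-reflexive (count-none P λ x → ¬-not λ Px → case cover x Px of λ { (() , _) })
count-≤-image {n = suc n} P Q f cover with Q zero in Q0
... | false = count-≤-image P (Q ∘ suc) (f ∘ suc) cover′
  where
  cover′ : ∀ x → P x ≡ true → ∃ λ y → Q (suc y) ≡ true × f (suc y) ≡ x
  cover′ x Px with cover x Px
  ... | zero , Qzero , _ = contradiction (trans (sym Qzero) Q0) λ ()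
  ... | suc y , Qy , fy≡x = y , Qy , fy≡x
... | true =
  ≤-trans (count-≤-∖ P (f zero)) (s≤s (count-≤-image (P ∖ f zero) (Q ∘ suc) (f ∘ suc) cover′))
  where
  cover′ : ∀ x → (P ∖ f zero) x ≡ true → ∃ λ y → Q (suc y) ≡ true × f (suc y) ≡ x
  cover′ x x∈P∖f0 with ∖-elim P x∈P∖f0
  ... | Px , x≢f0 with cover x Px
  ...   | zero , _ , f0≡x = contradiction (sym f0≡x) x≢f0
  ...   | suc y , Qy , fy≡x = y , Qy , fy≡x

≤-foldr-⊔ : ∀ {x xs} → x ∈ xs → x ≤ foldr _⊔_ 0 xs
≤-foldr-⊔ (here refl) = m≤m⊔n _ _
≤-foldr-⊔ (there x∈xs) = ≤-trans (≤-foldr-⊔ x∈xs) (m≤n⊔m _ _)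

deg≤Δ : ∀ {n} (G : Graph n) v → deg (adj G) v ≤ Δ G
deg≤Δ G v = ≤-foldr-⊔ (∈-map⁺ (deg (adj G)) (∈-allFin v))

deg≡count : ∀ {n} (A : Adj n) v → deg A v ≡ count (A v)
deg≡count A v = sum-indicator≡count (A v)

nDeg≡count : ∀ {n} (G : Graph n) j v → nDeg G j v ≡ count (λ x → adj G v x ∧ (deg (adj G) x ≡ᵇ j))
nDeg≡count G j v = sum-indicator≡count (λ x → adj G v x ∧ (deg (adj G) x ≡ᵇ j))

degree-two-neighbour : ∀ {n} (G : Graph n) v → nDeg G 2 v ≢ 0 →
  ∃ λ u → adj G u v ≡ true × deg (adj G) u ≡ 2
degree-two-neighbour G v n₂≢0
  with count-witness (λ x → adj G v x ∧ (deg (adj G) x ≡ᵇ 2)) (n₂≢0 ∘ trans (nDeg≡count G 2 v))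
... | u , e with ∧≡true⇒ e
...   | v∼u , deg≡ᵇ2 = u , trans (adj-sym G u v) v∼u , ≡ᵇ⇒≡ _ 2 (subst T (sym deg≡ᵇ2) tt)

adj⇒≢ : ∀ {n} (G : Graph n) {p q} → adj G p q ≡ true → p ≢ q
adj⇒≢ G {p} p∼q refl = contradiction (trans (sym p∼q) (irrefl G p)) λ ()

deleteEdgesAt : ∀ {n} → Adj n → Fin n → Adj n
deleteEdgesAt A u p q = A p q ∧ (not (p == u) ∧ not (q == u))

deleteEdgesAt-intro : ∀ {n} (A : Adj n) {u p q} → A p q ≡ true → p ≢ u → q ≢ u →
  deleteEdgesAt A u p q ≡ true
deleteEdgesAt-intro A p∼q p≢u q≢u rewrite p∼q | ≢⇒==-false p≢u | ≢⇒==-false q≢u = refl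

deleteEdgesAt-elim : ∀ {n} (A : Adj n) {u p q} → deleteEdgesAt A u p q ≡ true →
  A p q ≡ true × p ≢ u × q ≢ u
deleteEdgesAt-elim A e with ∧≡true⇒ e
... | p∼q , rest with ∧≡true⇒ rest
...   | p≠u , q≠u = p∼q , ==-false⇒≢ (not-injective p≠u) , ==-false⇒≢ (not-injective q≠u)

deleteEdgesAt⊆∖ : ∀ {n} (A : Adj n) {u z x} → deleteEdgesAt A u z x ≡ true → (A z ∖ u) x ≡ true
deleteEdgesAt⊆∖ A e = let (z∼x , _ , x≢u) = deleteEdgesAt-elim A e in ∖-intro (A _) z∼x x≢u

deleteEdgesAt-sym : ∀ {n} (A : Adj n) u → (∀ p q → A p q ≡ A q p) →
  ∀ p q → deleteEdgesAt A u p q ≡ deleteEdgesAt A u q p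
deleteEdgesAt-sym A u A-sym p q rewrite A-sym p q | ∧-comm (not (p == u)) (not (q == u)) = refl

_-ᵉ_ : ∀ {n} (G : Graph n) → Fin n → Subgraph G
G -ᵉ u = record
  { inV = λ _ → true
  ; adjH = deleteEdgesAt (adj G) u
  ; adjH-sym = deleteEdgesAt-sym (adj G) u (adj-sym G)
  ; adjH⊆ = λ _ _ → proj₁ ∘ deleteEdgesAt-elim (adj G)
  ; adjH-end = λ _ _ _ → refl
  }

-ᵉ-proper : ∀ {n} (G : Graph n) {u v} → adj G u v ≡ true → ProperSubgraph (G -ᵉ u)
-ᵉ-proper G {u} {v} u∼v = inj₂ (u , v , u∼v , u-isolated)
  where
  u-isolated : deleteEdgesAt (adj G) u u v ≡ false
  u-isolated rewrite ==-refl u = ∧-zeroʳ (adj G u v)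

-- Neighbours along a cycle

_∈[_,_] : ∀ {k} → Fin k → Fin k → Fin k → Set
x ∈[ a , b ] = x ≡ a ⊎ x ≡ b

∈[]-swap : ∀ {k} {a b α β γ : Fin k} → α ≢ β → α ∈[ a , b ] → β ∈[ a , b ] →
  γ ∈[ a , b ] → γ ∈[ α , β ]
∈[]-swap α≢β (inj₁ refl) (inj₁ refl) _ = contradiction refl α≢β
∈[]-swap α≢β (inj₂ refl) (inj₂ refl) _ = contradiction refl α≢β
∈[]-swap α≢β (inj₁ refl) (inj₂ refl) γ∈ab = γ∈ab
∈[]-swap α≢β (inj₂ refl) (inj₁ refl) (inj₁ γ≡a) = inj₂ γ≡a
∈[]-swap α≢β (inj₂ refl) (inj₁ refl) (inj₂ γ≡b) = inj₁ γ≡b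

OnCycle : ∀ {n} {A : Adj n} → Cycle A → Fin n → Set
OnCycle C p = ∃ λ i → vert C i ≡ p

module _ {n} {A : Adj n} (C : Cycle A) where

  private
    L : ℕ
    L = suc (suc (len C))

  data Succ : Fin (suc L) → Fin (suc L) → Set where
    next : ∀ i → Succ (inject₁ i) (suc i)
    wrap : Succ (fromℕ L) zero

  succ-exists : ∀ i → ∃ (Succ i)
  succ-exists i with view i
  ... | ‵fromℕ = zero , wrap
  ... | ‵inject₁ j = suc j , next j

  pred-exists : ∀ j → ∃ λ i → Succ i j
  pred-exists zero = fromℕ L , wrap
  pred-exists (suc j) = inject₁ j , next j

  toℕ-Succ : ∀ {i j} → Succ i j → toℕ j ≡ suc (toℕ i) ⊎ (toℕ i ≡ L × toℕ j ≡ 0)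
  toℕ-Succ (next i) = inj₁ (cong suc (sym (toℕ-inject₁ i)))
  toℕ-Succ wrap = inj₂ (toℕ-fromℕ L , refl)

  -- Cycles have length at least 3.
  Succ-no-2-cycle : ∀ {i j} → Succ i j → Succ j i → ⊥
  Succ-no-2-cycle i→j j→i with toℕ-Succ i→j | toℕ-Succ j→i
  ... | inj₁ j≡1+i | inj₁ i≡1+j = m≢1+n+m _ (trans j≡1+i (cong suc i≡1+j))
  ... | inj₁ j≡1+i | inj₂ (j≡L , i≡0) with () ← trans (sym j≡L) (trans j≡1+i (cong suc i≡0))
  ... | inj₂ (i≡L , j≡0) | inj₁ i≡1+j with () ← trans (sym i≡L) (trans i≡1+j (cong suc j≡0))
  ... | inj₂ (i≡L , _) | inj₂ (_ , i≡0) with () ← trans (sym i≡L) i≡0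

  Succ-adjacent : ∀ {i j} → Succ i j → A (vert C i) (vert C j) ≡ true
  Succ-adjacent (next i) = step C i
  Succ-adjacent wrap = close C

  cycle-neighbour-avoiding : ∀ i z → ∃ λ j → vert C j ≢ z × (Succ i j ⊎ Succ j i)
  cycle-neighbour-avoiding i z with succ-exists i | pred-exists i
  ... | s , i→s | p , p→i with vert C s ≟ z
  ...   | no s≢z = s , s≢z , inj₁ i→s
  ...   | yes s≡z = p , p≢z , inj₂ p→i
    where
    p≢z : vert C p ≢ z
    p≢z p≡z with inj C s p (trans s≡z (sym p≡z))
    ... | refl = Succ-no-2-cycle i→s p→i

  module _ (A-sym : ∀ p q → A p q ≡ A q p) {k} (c : EdgeColouring A k) {a b : Fin k}
    (steps : ∀ i → col c (vert C (inject₁ i)) (vert C (suc i)) ∈[ a , b ])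
    (closing : col c (vert C (fromℕ L)) (vert C zero) ∈[ a , b ]) where

    Succ-colour : ∀ {i j} → Succ i j → col c (vert C i) (vert C j) ∈[ a , b ]
    Succ-colour (next i) = steps i
    Succ-colour wrap = closing

    bichromatic-neighbour : ∀ {p} → OnCycle C p → ∀ z →
      ∃ λ q → OnCycle C q × q ≢ z × A p q ≡ true × col c p q ∈[ a , b ]
    bichromatic-neighbour (i , refl) z with cycle-neighbour-avoiding i z
    ... | j , j≢z , inj₁ i→j = vert C j , (j , refl) , j≢z , Succ-adjacent i→j , Succ-colour i→j
    ... | j , j≢z , inj₂ j→i =
      vert C j , (j , refl) , j≢z ,
      trans (A-sym _ _) (Succ-adjacent j→i) ,
      subst (_∈[ a , b ]) (col-sym c _ _ (Succ-adjacent j→i)) (Succ-colour j→i)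

cycle-avoiding : ∀ {n} {A : Adj n} {u} (C : Cycle A) → (∀ i → vert C i ≢ u) →
  Cycle (deleteEdgesAt A u)
cycle-avoiding {A = A} C u∉C = record
  { len = len C ; vert = vert C ; inj = inj C
  ; step = λ i → deleteEdgesAt-intro A (step C i) (u∉C _) (u∉C _)
  ; close = deleteEdgesAt-intro A (close C) (u∉C _) (u∉C _)
  }

-- Extending a colouring across a vertex of degree 2

Missing : ∀ {n k} {A : Adj n} → EdgeColouring A k → Fin n → Fin k → Set
Missing {A = A} c z γ = ∀ x → A z x ≡ true → col c z x ≢ γ

Walk₂ : ∀ {n k} {A : Adj n} → EdgeColouring A k → Fin n → Fin k → Fin k → Set
Walk₂ {A = A} c z β γ =
  ∃₂ λ x y → A z x ≡ true × col c z x ≡ β × A x y ≡ true × col c x y ≡ γ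

module Extension {n K} (G : Graph n) {u v w : Fin n}
  (v≢u : v ≢ u) (w≢v : w ≢ v) (N[u] : ∀ z → adj G u z ≡ true → z ≡ v ⊎ z ≡ w)
  (φ : EdgeColouring (deleteEdgesAt (adj G) u) K) (φ-proper : Proper φ) (φ-acyclic : Acyclic φ)
  {α β : Fin K} (α≢β : α ≢ β) (α∉v : Missing φ v α) (β∉w : Missing φ w β)
  (no-walk : ¬ Walk₂ φ v β α) where

  private
    A : Adj n
    A = adj G

    intro : ∀ {p q} → A p q ≡ true → p ≢ u → q ≢ u → deleteEdgesAt A u p q ≡ true
    intro = deleteEdgesAt-intro A

  f : Fin n → Fin K
  f z = if z == v then α else β

  f-v : f v ≡ α
  f-v rewrite ==-refl v = refl

  f-w : f w ≡ β
  f-w rewrite ≢⇒==-false w≢v = refl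

  f-missing : ∀ {z} → z ≡ v ⊎ z ≡ w → Missing φ z (f z)
  f-missing (inj₁ refl) rewrite f-v = α∉v
  f-missing (inj₂ refl) rewrite f-w = β∉w

  f-injective : ∀ {q r} → q ≡ v ⊎ q ≡ w → r ≡ v ⊎ r ≡ w → q ≢ r → f q ≢ f r
  f-injective (inj₁ refl) (inj₁ refl) q≢r = contradiction refl q≢r
  f-injective (inj₁ refl) (inj₂ refl) _ rewrite f-v | f-w = α≢β
  f-injective (inj₂ refl) (inj₁ refl) _ rewrite f-v | f-w = α≢β ∘ sym
  f-injective (inj₂ refl) (inj₂ refl) q≢r = contradiction refl q≢r

  extend : Fin n → Fin n → Fin K
  extend p q with p ≟ u | q ≟ u
  ... | yes _ | _ = f q
  ... | no _ | yes _ = f p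
  ... | no _ | no _ = col φ p q

  extend-from-u : ∀ q → extend u q ≡ f q
  extend-from-u q with u ≟ u
  ... | yes _ = refl
  ... | no u≢u = contradiction refl u≢u

  extend-to-u : ∀ {p} → p ≢ u → extend p u ≡ f p
  extend-to-u {p} p≢u with p ≟ u | u ≟ u
  ... | yes p≡u | _ = contradiction p≡u p≢u
  ... | no _ | yes _ = refl
  ... | no _ | no u≢u = contradiction refl u≢u

  extend-away : ∀ {p q} → p ≢ u → q ≢ u → extend p q ≡ col φ p q
  extend-away {p} {q} p≢u q≢u with p ≟ u | q ≟ u
  ... | yes p≡u | _ = contradiction p≡u p≢u
  ... | no _ | yes q≡u = contradiction q≡u q≢u
  ... | no _ | no _ = refl

  extend-sym : ∀ p q → A p q ≡ true → extend p q ≡ extend q p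
  extend-sym p q p∼q with toSum (p ≟ u) | toSum (q ≟ u)
  ... | inj₁ refl | inj₁ refl = contradiction refl (adj⇒≢ G p∼q)
  ... | inj₁ refl | inj₂ q≢u = trans (extend-from-u q) (sym (extend-to-u q≢u))
  ... | inj₂ p≢u | inj₁ refl = trans (extend-to-u p≢u) (sym (extend-from-u p))
  ... | inj₂ p≢u | inj₂ q≢u = begin
    extend p q  ≡⟨ extend-away p≢u q≢u ⟩
    col φ p q   ≡⟨ col-sym φ p q (intro p∼q p≢u q≢u) ⟩
    col φ q p   ≡⟨ extend-away q≢u p≢u ⟨
    extend q p  ∎
    where open ≡-Reasoning

  ψ : EdgeColouring A K
  ψ = record { col = extend ; col-sym = extend-sym }

  ψ-proper : Proper ψ
  ψ-proper p q r p∼q p∼r q≢r with toSum (p ≟ u)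
  ... | inj₁ refl rewrite extend-from-u q | extend-from-u r = f-injective (N[u] q p∼q) (N[u] r p∼r) q≢r
  ... | inj₂ p≢u with toSum (q ≟ u) | toSum (r ≟ u)
  ...   | inj₁ refl | inj₁ refl = contradiction refl q≢r
  ...   | inj₁ refl | inj₂ r≢u rewrite extend-to-u p≢u | extend-away p≢u r≢u =
    f-missing (N[u] p (trans (adj-sym G u p) p∼q)) r (intro p∼r p≢u r≢u) ∘ sym
  ...   | inj₂ q≢u | inj₁ refl rewrite extend-to-u p≢u | extend-away p≢u q≢u =
    f-missing (N[u] p (trans (adj-sym G u p) p∼r)) q (intro p∼q p≢u q≢u)
  ...   | inj₂ q≢u | inj₂ r≢u rewrite extend-away p≢u q≢u | extend-away p≢u r≢u =
    φ-proper p q r (intro p∼q p≢u q≢u) (intro p∼r p≢u r≢u) q≢r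

  -- The colours of a ψ-bichromatic cycle through u are ψ(uv) = α and ψ(uw) = β; leaving v
  -- away from u it must take a β-edge and then an α-edge, which is the excluded walk.
  module ThroughU (C : Cycle A) {a b : Fin K}
    (steps : ∀ i → extend (vert C (inject₁ i)) (vert C (suc i)) ∈[ a , b ])
    (closing : extend (vert C (fromℕ (suc (suc (len C))))) (vert C zero) ∈[ a , b ])
    (u∈C : OnCycle C u) where

    neighbour : ∀ {p} → OnCycle C p → ∀ z →
      ∃ λ q → OnCycle C q × q ≢ z × A p q ≡ true × extend p q ∈[ a , b ]
    neighbour = bichromatic-neighbour C (adj-sym G) ψ steps closing

    neighbour-of-u : ∀ {q} → A u q ≡ true → q ≢ w → q ≡ v
    neighbour-of-u {q} u∼q q≢w with N[u] q u∼q
    ... | inj₁ q≡v = q≡v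
    ... | inj₂ q≡w = contradiction q≡w q≢w

    other-neighbour-of-u : ∀ {q} → A u q ≡ true → q ≢ v → q ≡ w
    other-neighbour-of-u {q} u∼q q≢v with N[u] q u∼q
    ... | inj₁ q≡v = contradiction q≡v q≢v
    ... | inj₂ q≡w = q≡w

    colours : ∀ {γ} → γ ∈[ a , b ] → γ ∈[ α , β ]
    colours = ∈[]-swap α≢β α∈ab β∈ab
      where
      α∈ab : α ∈[ a , b ]
      α∈ab with neighbour u∈C w
      ... | q , _ , q≢w , u∼q , uq∈ab with neighbour-of-u u∼q q≢w
      ...   | refl = subst (_∈[ a , b ]) (trans (extend-from-u v) f-v) uq∈ab
      β∈ab : β ∈[ a , b ]
      β∈ab with neighbour u∈C v
      ... | q , _ , q≢v , u∼q , uq∈ab with other-neighbour-of-u u∼q q≢v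
      ...   | refl = subst (_∈[ a , b ]) (trans (extend-from-u w) f-w) uq∈ab

    walk : Walk₂ φ v β α
    walk with neighbour u∈C w
    ... | v′ , v′∈C , v′≢w , u∼v′ , _ with neighbour-of-u u∼v′ v′≢w
    ...   | refl with neighbour v′∈C u
    ...     | x , x∈C , x≢u , v∼x , vx∈ab with neighbour x∈C v
    ...       | y , _ , y≢v , x∼y , xy∈ab =
      x , y , intro v∼x v≢u x≢u , vx≡β , intro x∼y x≢u y≢u , trans (sym (extend-away x≢u y≢u)) xy≡α
      where
      vx≡β : col φ v x ≡ β
      vx≡β with colours vx∈ab
      ... | inj₁ vx≡α = contradiction (trans (sym (extend-away v≢u x≢u)) vx≡α) (α∉v x (intro v∼x v≢u x≢u))
      ... | inj₂ vx≡β = trans (sym (extend-away v≢u x≢u)) vx≡β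
      x∼v : A x v ≡ true
      x∼v = trans (adj-sym G x v) v∼x
      xy≡α : extend x y ≡ α
      xy≡α with colours xy∈ab
      ... | inj₁ xy≡α = xy≡α
      ... | inj₂ xy≡β = contradiction (trans xy≡β (sym xv≡β)) (ψ-proper x y v x∼y x∼v y≢v)
        where
        xv≡β : extend x v ≡ β
        xv≡β = trans (extend-sym x v x∼v) (trans (extend-away v≢u x≢u) vx≡β)
      y≢u : y ≢ u
      y≢u refl with N[u] x (trans (adj-sym G u x) x∼y)
      ... | inj₁ refl = adj⇒≢ G v∼x refl
      ... | inj₂ refl = α≢β (trans (sym xy≡α) (trans (extend-to-u x≢u) f-w))

  ψ-acyclic : Acyclic ψ
  ψ-acyclic C (a , b , steps , closing) with any? (λ i → vert C i ≟ u)
  ... | yes u∈C = no-walk (ThroughU.walk C steps closing u∈C)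
  ... | no u∉C = φ-acyclic (cycle-avoiding C u∉C′) (a , b , steps′ , closing′)
    where
    u∉C′ : ∀ i → vert C i ≢ u
    u∉C′ i Ci≡u = u∉C (i , Ci≡u)
    steps′ : ∀ i → col φ (vert C (inject₁ i)) (vert C (suc i)) ∈[ a , b ]
    steps′ i = subst (_∈[ a , b ]) (extend-away (u∉C′ _) (u∉C′ _)) (steps i)
    closing′ : col φ (vert C (fromℕ (suc (suc (len C))))) (vert C zero) ∈[ a , b ]
    closing′ = subst (_∈[ a , b ]) (extend-away (u∉C′ _) (u∉C′ _)) closing

  colourable : AcyclicallyColourable A K
  colourable = ψ , ψ-proper , ψ-acyclic

module DegreeTwoNeighbour {n} (G : Graph n) (critical : AcyclicallyEdgeCritical G (Δ G + 2))
  {u v w : Fin n} (u∼v : adj G u v ≡ true) (u∼w : adj G u w ≡ true) (w≢v : w ≢ v)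
  (N[u] : ∀ z → adj G u z ≡ true → z ≡ v ⊎ z ≡ w) where

  private
    A : Adj n
    A = adj G

    Ã : Adj n
    Ã = deleteEdgesAt A u

    K : ℕ
    K = Δ G + 2

    colouring : AcyclicallyColourable Ã K
    colouring = proj₂ critical (G -ᵉ u) (-ᵉ-proper G u∼v)

    φ : EdgeColouring Ã K
    φ = proj₁ colouring

    φ-proper : Proper φ
    φ-proper = proj₁ (proj₂ colouring)

    φ-acyclic : Acyclic φ
    φ-acyclic = proj₂ (proj₂ colouring)

    v∼u : A v u ≡ true
    v∼u = trans (adj-sym G v u) u∼v

    w∼u : A w u ≡ true
    w∼u = trans (adj-sym G w u) u∼w

  no-extension : ∀ {α β} → α ≢ β → Missing φ v α → Missing φ w β → ¬ ¬ Walk₂ φ v β α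
  no-extension α≢β α∉v β∉w no-walk = proj₁ critical
    (Extension.colourable G (adj⇒≢ G v∼u) w≢v N[u] φ φ-proper φ-acyclic α≢β α∉v β∉w no-walk)

  coloured? : ∀ z γ → Dec (∃ λ x → Ã z x ≡ true × col φ z x ≡ γ)
  coloured? z γ = any? λ x → (Ã z x Bool.≟ true) ×-dec (col φ z x ≟ γ)

  missingᵇ : Fin n → Fin K → Bool
  missingᵇ z γ = not (does (coloured? z γ))

  missingᵇ-sound : ∀ {z γ} → missingᵇ z γ ≡ true → Missing φ z γ
  missingᵇ-sound {z} {γ} e x z∼x zx≡γ with coloured? z γ | e
  ... | no none | _ = none (x , z∼x , zx≡γ)

  used-witness : ∀ {z γ} → not (missingᵇ z γ) ≡ true → ∃ λ x → Ã z x ≡ true × col φ z x ≡ γ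
  used-witness {z} {γ} e with coloured? z γ | e
  ... | yes edge | _ = edge

  three-missing : ∀ {z} → A z u ≡ true → 3 ≤ count (missingᵇ z)
  three-missing {z} z∼u = +-cancelˡ-≤ U 3 M (begin
    U + 3      ≡⟨ +-suc U 2 ⟩
    suc U + 2  ≤⟨ +-monoˡ-≤ 2 used<Δ ⟩
    Δ G + 2    ≡⟨ count-complement (missingᵇ z) ⟨
    M + U      ≡⟨ +-comm M U ⟩
    U + M      ∎)
    where
    open ≤-Reasoning
    M = count (missingᵇ z)
    U = count (not ∘ missingᵇ z)
    used<Δ : suc U ≤ Δ G
    used<Δ = begin
      suc U                  ≤⟨ s≤s (count-≤-image (not ∘ missingᵇ z) (Ã z) (col φ z) (λ _ → used-witness)) ⟩
      suc (count (Ã z))      ≤⟨ s≤s (count-mono (Ã z) (A z ∖ u) (λ _ → deleteEdgesAt⊆∖ A)) ⟩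
      suc (count (A z ∖ u))  ≡⟨ count-∖ (A z) z∼u ⟨
      count (A z)            ≡⟨ deg≡count A z ⟨
      deg A z                ≤⟨ deg≤Δ G z ⟩
      Δ G                    ∎

  edge-coloured-at-v : ∀ {β} → Missing φ w β → ∃ λ x → Ã v x ≡ true × col φ v x ≡ β
  edge-coloured-at-v {β} β∉w = decidable-stable (coloured? v β) λ no-edge →
    let (α , α-missing , α≢β) = count-other (missingᵇ v) (≤-trans (n≤1+n 2) (three-missing v∼u)) β
    in no-extension α≢β (missingᵇ-sound α-missing) β∉w
         λ (x , _ , v∼x , vx≡β , _) → no-edge (x , v∼x , vx≡β)

  walk-continues : ∀ {α β x} → Missing φ w β → Ã v x ≡ true → col φ v x ≡ β → Missing φ v α →
    ∃ λ y → Ã x y ≡ true × col φ x y ≡ α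
  walk-continues {α} {β} {x} β∉w v∼x vx≡β α∉v = decidable-stable (coloured? x α) λ no-edge →
    no-extension α≢β α∉v β∉w λ (x′ , y , v∼x′ , vx′≡β , x′∼y , x′y≡α) →
      case x′≡x v∼x′ vx′≡β of λ { refl → no-edge (y , x′∼y , x′y≡α) }
    where
    α≢β : α ≢ β
    α≢β α≡β = α∉v x v∼x (trans vx≡β (sym α≡β))
    x′≡x : ∀ {x′} → Ã v x′ ≡ true → col φ v x′ ≡ β → x′ ≡ x
    x′≡x {x′} v∼x′ vx′≡β = decidable-stable (x′ ≟ x) λ x′≢x →
      φ-proper v x′ x v∼x′ v∼x x′≢x (trans vx′≡β (sym vx≡β))

  four-≤-deg : ∀ {β x} → Missing φ w β → Ã v x ≡ true → col φ v x ≡ β → 4 ≤ deg A x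
  four-≤-deg {β} {x} β∉w v∼x vx≡β = begin
    4                         ≤⟨ s≤s (three-missing v∼u) ⟩
    suc (count (missingᵇ v))  ≤⟨ s≤s (count-≤-image (missingᵇ v) (A x ∖ v) (col φ x) cover) ⟩
    suc (count (A x ∖ v))     ≡⟨ count-∖ (A x) x∼v ⟨
    count (A x)               ≡⟨ deg≡count A x ⟨
    deg A x                   ∎
    where
    open ≤-Reasoning
    x∼v : A x v ≡ true
    x∼v = trans (adj-sym G x v) (proj₁ (deleteEdgesAt-elim A v∼x))
    cover : ∀ α → missingᵇ v α ≡ true → ∃ λ y → (A x ∖ v) y ≡ true × col φ x y ≡ α
    cover α α-missing with walk-continues β∉w v∼x vx≡β (missingᵇ-sound α-missing)
    ... | y , x∼y , xy≡α = y , ∖-intro (A x) (proj₁ (deleteEdgesAt-elim A x∼y)) y≢v , xy≡α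
      where
      y≢v : y ≢ v
      y≢v refl = missingᵇ-sound α-missing x v∼x (trans (col-sym φ v x v∼x) xy≡α)

  Heavy : Fin n → Bool
  Heavy x = heavy (A v x) (deg A x)
    where
    heavy : Bool → ℕ → Bool
    heavy a d = (a ∧ not (d ≡ᵇ 2)) ∧ not (d ≡ᵇ 3)

  three-heavy : 3 ≤ count Heavy
  three-heavy = ≤-trans (three-missing w∼u) (count-≤-image (missingᵇ w) Heavy (col φ v) cover)
    where
    heavy : ∀ {x} → A v x ≡ true → 4 ≤ deg A x → Heavy x ≡ true
    heavy {x} v∼x 4≤deg with A v x | deg A x | v∼x | 4≤deg
    ... | true | _ | refl | s≤s (s≤s (s≤s (s≤s _))) = refl
    cover : ∀ β → missingᵇ w β ≡ true → ∃ λ x → Heavy x ≡ true × col φ v x ≡ β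
    cover β β-missing =
      let (x , v∼x , vx≡β) = edge-coloured-at-v (missingᵇ-sound β-missing) in
      x ,
      heavy {x} (proj₁ (deleteEdgesAt-elim A v∼x)) (four-≤-deg (missingᵇ-sound β-missing) v∼x vx≡β) ,
      vx≡β

  n₂+n₃+3≤Δ : nDeg G 2 v + nDeg G 3 v + 3 ≤ Δ G
  n₂+n₃+3≤Δ = begin
    nDeg G 2 v + nDeg G 3 v + 3
      ≡⟨ cong₂ (λ a b → a + b + 3) (nDeg≡count G 2 v) (nDeg≡count G 3 v) ⟩
    count deg2 + count deg3 + 3
      ≤⟨ +-monoʳ-≤ (count deg2 + count deg3) three-heavy ⟩
    count deg2 + count deg3 + count Heavy
      ≤⟨ +-monoˡ-≤ (count Heavy) (+-monoʳ-≤ (count deg2) (count-mono deg3 not2∧3 deg3⇒not2∧3)) ⟩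
    count deg2 + count not2∧3 + count Heavy
      ≡⟨ +-assoc (count deg2) (count not2∧3) (count Heavy) ⟩
    count deg2 + (count not2∧3 + count Heavy)
      ≡⟨ cong (count deg2 +_) (count-split not2 (λ x → deg A x ≡ᵇ 3)) ⟨
    count deg2 + count not2
      ≡⟨ count-split (A v) (λ x → deg A x ≡ᵇ 2) ⟨
    count (A v)  ≡⟨ deg≡count A v ⟨
    deg A v      ≤⟨ deg≤Δ G v ⟩
    Δ G          ∎
    where
    open ≤-Reasoning
    deg2 deg3 not2 not2∧3 : Fin n → Bool
    deg2 x = A v x ∧ (deg A x ≡ᵇ 2)
    deg3 x = A v x ∧ (deg A x ≡ᵇ 3)
    not2 x = A v x ∧ not (deg A x ≡ᵇ 2)
    not2∧3 x = not2 x ∧ (deg A x ≡ᵇ 3)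
    deg3⇒not2∧3 : ∀ x → deg3 x ≡ true → not2∧3 x ≡ true
    deg3⇒not2∧3 x = lemma (A v x) (deg A x)
      where
      lemma : ∀ a d → a ∧ (d ≡ᵇ 3) ≡ true → (a ∧ not (d ≡ᵇ 2)) ∧ (d ≡ᵇ 3) ≡ true
      lemma true 3 _ = refl
      lemma false _ ()
      lemma true 0 ()
      lemma true 1 ()
      lemma true 2 ()
      lemma true (suc (suc (suc (suc _)))) ()

corollary4 : ∀ (n : ℕ) (G : Graph n) → AcyclicallyEdgeCritical G (Δ G + 2) →
  ∀ (v : Fin n) → nDeg G 2 v ≢ 0 → nDeg G 2 v + nDeg G 3 v + 3 ≤ Δ G
corollary4 n G critical v n₂≢0 with degree-two-neighbour G v n₂≢0
... | u , u∼v , deg-u≡2 with count-≡2 (adj G u) (trans (sym (deg≡count (adj G) u)) deg-u≡2) u∼v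
...   | w , w≢v , u∼w , N[u] = DegreeTwoNeighbour.n₂+n₃+3≤Δ G critical u∼v u∼w w≢v N[u]
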